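{- Let $n\ge1$ and let $\lambda\in P(n)$ be a partition at which $N(1,3;\lambda)$ attains its maximum over $P(n)$. If $\lambda$ has a part equal to $2$, then $\lambda=(2)$ or $\lambda=(2,2)$.
   Context: $P(n)$ is the set of partitions of $n$. $N(1,3;m)$ is the number of partitions of $m$ whose rank (largest part minus number of parts) is $\equiv1\pmod3$, and for $\lambda=(\lambda_1,\dots,\lambda_k)$, $N(1,3;\lambda):=\prod_{j=1}^kN(1,3;\lambda_j)$. -}

module Defs where

open import Data.Nat using (ℕ; zero; suc; _+_; _∸_; _≤_; _≥_; _⊓_)
open import Data.Nat.Properties using (_≟_)
open import Data.Integer as ℤ using (ℤ; +_)
open import Data.Integer.DivMod using (_%ℕ_)
open import Data.List using (List; []; _∷_; length; map; concatMap; filter; upTo)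
open import Data.Nat.ListAction using (sum; product)
open import Data.List.Relation.Unary.All using (All)
open import Data.List.Relation.Unary.Linked using (Linked)
open import Data.Product using (_×_)
open import Relation.Binary.PropositionalEquality using (_≡_)

IsPartition : ℕ → List ℕ → Set
IsPartition n λs = Linked _≥_ λs × All (1 ≤_) λs × sum λs ≡ n

largestPart : List ℕ → ℕ
largestPart []      = 0
largestPart (x ∷ _) = x

rank : List ℕ → ℤ
rank λs = + largestPart λs ℤ.- + length λs

-- explicit enumeration: parts n k f = all weakly decreasing lists of positive
-- integers with parts ≤ k summing to n (f is fuel, f ≥ n suffices)
parts : ℕ → ℕ → ℕ → List (List ℕ)
parts zero    zero    k = [] ∷ []
parts (suc f) zero    k = [] ∷ []
parts zero    (suc n) k = []
parts (suc f) (suc n) k =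
  concatMap (λ i → map (suc i ∷_) (parts f (suc n ∸ suc i) (suc i))) (upTo (suc n ⊓ k))

partitions : ℕ → List (List ℕ)
partitions m = parts m m m

N13 : ℕ → ℕ
N13 m = length (filter (λ μ → (rank μ %ℕ 3) ≟ 1) (partitions m))

N13P : List ℕ → ℕ
N13P λs = product (map N13 λs)

-- A maximiser has N(1,3;λ) ≥ 1 (parts 2 and one 3 give 1), hence no part 1 as N(1,3;1) = 0, and at
-- most two parts 2, as (2,2,2) can be traded for (6) with N(1,3;6) = 4 > 1. Any other part a ≥ 3 can absorb a part 2, because
-- N(1,3;a) < N(1,3;a+2) for a ≥ 3. For the latter, raising the largest part by 1 and appending a
-- part 1 maps the partitions of a injectively and rank-preservingly to partitions of a + 2; it
-- misses (1,…,1), (a+2) and every (2,2,…) with parts ≤ 2, and according to a mod 3 one of these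
-- has rank ≡ 1. On counts, the map is read off the recursion of the enumeration by largest part.
module Submission where

open import Defs
open import Function using (_∘_)
open import Data.Bool using (true; false)
open import Data.Nat
open import Data.Nat.Properties
open import Data.Nat.DivMod using ([m+n]%n≡m%n; [m+kn]%n≡m%n; m≡m%n+[m/n]*n; m%n<n)
open import Data.Nat.Divisibility using (0∣⇒≡0)
open import Data.Nat.ListAction using (sum; product)
open import Data.Nat.ListAction.Properties using (sum-++; sum-↭; product-++; product-↭; ∈⇒∣product)
open import Data.Nat.Tactic.RingSolver using (solve-∀)
open import Data.Integer using (-[1+_]; _⊖_)
open import Data.Integer.Properties using ([1+m]⊖[1+n]≡m⊖n)
open import Data.Integer.DivMod using (_%ℕ_)
open import Data.List using (List; []; _∷_; _++_; length; map; filter; concatMap; applyUpTo; upTo)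
open import Data.List.Properties using (map-++; concatMap-cong)
open import Data.List.Relation.Unary.All using (All; []; _∷_; lookup; tabulate)
open import Data.List.Relation.Unary.All.Properties using (++⁺; ++⁻ʳ)
open import Data.List.Relation.Unary.Any using (here; there)
open import Data.List.Membership.Propositional using (_∈_)
open import Data.List.Membership.Propositional.Properties using (∈-∃++; ∈-map⁺)
open import Data.List.Relation.Binary.Permutation.Propositional using (_↭_; ↭-refl; ↭-sym; ↭-trans; prep)
open import Data.List.Relation.Binary.Permutation.Propositional.Properties
  using (shift; map⁺; All-resp-↭; ∈-resp-↭)
open import Relation.Binary.Properties.DecTotalOrder ≤-decTotalOrder using (≥-decTotalOrder)
import Data.List.Sort as Sort
open import Data.Product using (∃-syntax; _×_; _,_)
open import Data.Sum using (_⊎_; inj₁; inj₂)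
open import Relation.Nullary using (contradiction)
open import Relation.Binary.PropositionalEquality

count₁ : {A : Set} → (A → ℕ) → List A → ℕ
count₁ w xs = length (filter (λ x → w x ≟ 1) xs)

count₁-cong : {A : Set} {v w : A → ℕ} → (∀ x → v x ≡ w x) → ∀ xs → count₁ v xs ≡ count₁ w xs
count₁-cong v≗w []       = refl
count₁-cong {w = w} v≗w (x ∷ xs) rewrite v≗w x with w x ≡ᵇ 1
... | true  = cong suc (count₁-cong v≗w xs)
... | false = count₁-cong v≗w xs

count₁-++ : {A : Set} (w : A → ℕ) → ∀ xs ys → count₁ w (xs ++ ys) ≡ count₁ w xs + count₁ w ys
count₁-++ w []       ys = refl
count₁-++ w (x ∷ xs) ys with w x ≡ᵇ 1
... | true  = cong suc (count₁-++ w xs ys)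
... | false = count₁-++ w xs ys

count₁-map : {A B : Set} (w : B → ℕ) (f : A → B) → ∀ xs → count₁ w (map f xs) ≡ count₁ (w ∘ f) xs
count₁-map w f []       = refl
count₁-map w f (x ∷ xs) with w (f x) ≡ᵇ 1
... | true  = cong suc (count₁-map w f xs)
... | false = count₁-map w f xs

∑< : ℕ → (ℕ → ℕ) → ℕ
∑< zero    g = 0
∑< (suc n) g = g 0 + ∑< n (g ∘ suc)

∑<-cong : ∀ n {g h : ℕ → ℕ} → (∀ i → g i ≡ h i) → ∑< n g ≡ ∑< n h
∑<-cong zero    g≗h = refl
∑<-cong (suc n) g≗h = cong₂ _+_ (g≗h 0) (∑<-cong n (g≗h ∘ suc))

∑<-+ : ∀ m d g → ∑< (m + d) g ≡ ∑< m g + ∑< d (λ i → g (m + i))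
∑<-+ zero    d g = refl
∑<-+ (suc m) d g = trans (cong (g 0 +_) (∑<-+ m d (g ∘ suc))) (sym (+-assoc (g 0) _ _))

∑<-last : ∀ n g → ∑< (suc n) g ≡ ∑< n g + g n
∑<-last zero    g = +-identityʳ (g 0)
∑<-last (suc n) g = trans (cong (g 0 +_) (∑<-last n (g ∘ suc))) (sym (+-assoc (g 0) _ _))

∑<-monoˡ-≤ : ∀ {m m′} g → m ≤ m′ → ∑< m g ≤ ∑< m′ g
∑<-monoˡ-≤ {m} {m′} g m≤m′ = begin
  ∑< m g                                      ≤⟨ m≤m+n _ _ ⟩
  ∑< m g + ∑< (m′ ∸ m) (λ i → g (m + i))      ≡⟨ ∑<-+ m (m′ ∸ m) g ⟨
  ∑< (m + (m′ ∸ m)) g                         ≡⟨ cong (λ t → ∑< t g) (m+[n∸m]≡n m≤m′) ⟩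
  ∑< m′ g                                     ∎
  where open ≤-Reasoning

∑<-mono-≤ : ∀ n {g h : ℕ → ℕ} → (∀ i → i < n → g i ≤ h i) → ∑< n g ≤ ∑< n h
∑<-mono-≤ zero    g≤h = z≤n
∑<-mono-≤ (suc n) g≤h = +-mono-≤ (g≤h 0 (s≤s z≤n)) (∑<-mono-≤ n (λ i i<n → g≤h (suc i) (s≤s i<n)))

count₁-concatMap : {A B : Set} (w : B → ℕ) (h : A → List B) (f : ℕ → A) → ∀ n →
  count₁ w (concatMap h (applyUpTo f n)) ≡ ∑< n (λ i → count₁ w (h (f i)))
count₁-concatMap w h f zero    = refl
count₁-concatMap w h f (suc n) =
  trans (count₁-++ w (h (f 0)) _) (cong (count₁ w (h (f 0)) +_) (count₁-concatMap w h (f ∘ suc) n))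

negMod3 : ℕ → ℕ
negMod3 zero    = 0
negMod3 (suc r) = 3 ∸ suc r

-[1+n]%ℕ3≡negMod3 : ∀ n → -[1+ n ] %ℕ 3 ≡ negMod3 (suc n % 3)
-[1+n]%ℕ3≡negMod3 n with suc n % 3
... | zero  = refl
... | suc r = refl

-[1+n]%ℕ3 : ∀ n → -[1+ n ] %ℕ 3 ≡ (2 * suc n) % 3
-[1+n]%ℕ3 0 = refl
-[1+n]%ℕ3 1 = refl
-[1+n]%ℕ3 2 = refl
-[1+n]%ℕ3 (suc (suc (suc n))) = begin
  -[1+ 3 + n ] %ℕ 3              ≡⟨ -[1+n]%ℕ3≡negMod3 (3 + n) ⟩
  negMod3 ((3 + suc n) % 3)      ≡⟨ cong (λ t → negMod3 (t % 3)) (+-comm 3 (suc n)) ⟩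
  negMod3 ((suc n + 3) % 3)      ≡⟨ cong negMod3 ([m+n]%n≡m%n (suc n) 3) ⟩
  negMod3 (suc n % 3)            ≡⟨ -[1+n]%ℕ3≡negMod3 n ⟨
  -[1+ n ] %ℕ 3                  ≡⟨ -[1+n]%ℕ3 n ⟩
  (2 * suc n) % 3                ≡⟨ [m+kn]%n≡m%n (2 * suc n) 2 3 ⟨
  (2 * suc n + 2 * 3) % 3        ≡⟨ cong (_% 3) (*-distribˡ-+ 2 (suc n) 3) ⟨
  (2 * (suc n + 3)) % 3          ≡⟨ cong (λ t → (2 * t) % 3) (+-comm (suc n) 3) ⟩
  (2 * suc (3 + n)) % 3          ∎
  where open ≡-Reasoning

⊖%ℕ3 : ∀ x y → (x ⊖ y) %ℕ 3 ≡ (x + 2 * y) % 3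
⊖%ℕ3 x       zero    = cong (_% 3) (sym (+-identityʳ x))
⊖%ℕ3 zero    (suc y) = -[1+n]%ℕ3 y
⊖%ℕ3 (suc x) (suc y) = begin
  (suc x ⊖ suc y) %ℕ 3          ≡⟨ cong (_%ℕ 3) ([1+m]⊖[1+n]≡m⊖n x y) ⟩
  (x ⊖ y) %ℕ 3                  ≡⟨ ⊖%ℕ3 x y ⟩
  (x + 2 * y) % 3               ≡⟨ [m+n]%n≡m%n (x + 2 * y) 3 ⟨
  (x + 2 * y + 3) % 3           ≡⟨ cong (_% 3) (regroup x y) ⟩
  (suc x + 2 * suc y) % 3       ∎
  where
  open ≡-Reasoning
  regroup : ∀ x y → x + 2 * y + 3 ≡ suc x + 2 * suc y
  regroup = solve-∀

rank-∷-%ℕ3 : ∀ i μ → rank (suc i ∷ μ) %ℕ 3 ≡ (2 * length μ + (i + 3)) % 3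
rank-∷-%ℕ3 i μ = trans (⊖%ℕ3 (suc i) (suc (length μ))) (cong (_% 3) (regroup i (length μ)))
  where
  regroup : ∀ i ℓ → suc i + 2 * suc ℓ ≡ 2 * ℓ + (i + 3)
  regroup = solve-∀

partitionsAtMost : ℕ → ℕ → List (List ℕ)
partitionsAtMost n k = parts n n k

parts-fuel-suc : ∀ f n k → n ≤ f → parts (suc f) n k ≡ parts f n k
parts-fuel-suc zero    zero    k _         = refl
parts-fuel-suc (suc f) zero    k _         = refl
parts-fuel-suc (suc f) (suc n) k (s≤s n≤f) =
  concatMap-cong {f = withFirstPart (suc f)} {g = withFirstPart f} fuel-irrelevant (upTo (suc n ⊓ k))
  where
  withFirstPart : ℕ → ℕ → List (List ℕ)
  withFirstPart fuel i = map (suc i ∷_) (parts fuel (n ∸ i) (suc i))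
  fuel-irrelevant : ∀ i → withFirstPart (suc f) i ≡ withFirstPart f i
  fuel-irrelevant i = cong (map (suc i ∷_)) (parts-fuel-suc f (n ∸ i) (suc i) (≤-trans (m∸n≤m n i) n≤f))

parts-fuel : ∀ {n f} k → n ≤′ f → parts f n k ≡ partitionsAtMost n k
parts-fuel k ≤′-refl       = refl
parts-fuel k (≤′-step n≤f) = trans (parts-fuel-suc _ _ k (≤′⇒≤ n≤f)) (parts-fuel k n≤f)

count₁-partitionsAtMost-suc : (w : List ℕ → ℕ) → ∀ n k →
  count₁ w (partitionsAtMost (suc n) k)
    ≡ ∑< (suc n ⊓ k) (λ i → count₁ (w ∘ (suc i ∷_)) (partitionsAtMost (n ∸ i) (suc i)))
count₁-partitionsAtMost-suc w n k =
  trans (count₁-concatMap w (λ i → map (suc i ∷_) (parts n (n ∸ i) (suc i))) (λ i → i) (suc n ⊓ k))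
        (∑<-cong (suc n ⊓ k) λ i →
          trans (count₁-map w (suc i ∷_) (parts n (n ∸ i) (suc i)))
                (cong (count₁ (w ∘ (suc i ∷_))) (parts-fuel (suc i) (≤⇒≤′ (m∸n≤m n i)))))

-- As rank (i + 1 ∷ μ) ≡ i + 1 + 2 (1 + length μ) (mod 3), N13 splits into these counts.
lenCount : ℕ → ℕ → ℕ → ℕ
lenCount n k r = count₁ (λ μ → (2 * length μ + r) % 3) (partitionsAtMost n k)

lenCount-suc : ∀ n k r → lenCount (suc n) k r ≡ ∑< (suc n ⊓ k) (λ i → lenCount (n ∸ i) (suc i) (r + 2))
lenCount-suc n k r = trans (count₁-partitionsAtMost-suc (λ μ → (2 * length μ + r) % 3) n k)
  (∑<-cong (suc n ⊓ k) λ i →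
    count₁-cong (λ μ → cong (_% 3) (regroup (length μ) r)) (partitionsAtMost (n ∸ i) (suc i)))
  where
  regroup : ∀ ℓ r → 2 * suc ℓ + r ≡ 2 * ℓ + (r + 2)
  regroup = solve-∀

N13-suc : ∀ m → N13 (suc m) ≡ ∑< (suc m) (λ i → lenCount (m ∸ i) (suc i) (i + 3))
N13-suc m = begin
  N13 (suc m)                     ≡⟨ count₁-partitionsAtMost-suc (λ μ → rank μ %ℕ 3) m (suc m) ⟩
  ∑< (suc m ⊓ suc m) rankCount    ≡⟨ cong (λ t → ∑< t rankCount) (⊓-idem (suc m)) ⟩
  ∑< (suc m) rankCount            ≡⟨ ∑<-cong (suc m) (λ i →
                                       count₁-cong (rank-∷-%ℕ3 i) (partitionsAtMost (m ∸ i) (suc i))) ⟩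
  ∑< (suc m) (λ i → lenCount (m ∸ i) (suc i) (i + 3)) ∎
  where
  open ≡-Reasoning
  rankCount : ℕ → ℕ
  rankCount i = count₁ (λ μ → rank (suc i ∷ μ) %ℕ 3) (partitionsAtMost (m ∸ i) (suc i))

lenCount-nil : ∀ k r → r % 3 ≡ 1 → lenCount 0 k r ≡ 1
lenCount-nil k r r%3≡1 rewrite r%3≡1 = refl

lenCount-nil-1+3q : ∀ k q → lenCount 0 k (1 + q * 3) ≡ 1
lenCount-nil-1+3q k q = lenCount-nil k (1 + q * 3) ([m+kn]%n≡m%n 1 q 3)

lenCount-+3 : ∀ n k r → lenCount n k (r + 3) ≡ lenCount n k r
lenCount-+3 n k r = count₁-cong (λ μ →
  trans (cong (_% 3) (sym (+-assoc (2 * length μ) r 3))) ([m+n]%n≡m%n (2 * length μ + r) 3)) (partitionsAtMost n k)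

lenCount-ones : ∀ n r → lenCount n 1 r ≡ lenCount 0 0 (2 * n + r)
lenCount-ones zero    r = refl
lenCount-ones (suc n) r = begin
  lenCount (suc n) 1 r                ≡⟨ lenCount-suc n 1 r ⟩
  ∑< (suc n ⊓ 1) term                 ≡⟨ cong (λ t → ∑< (suc t) term) (⊓-zeroʳ n) ⟩
  lenCount n 1 (r + 2) + 0            ≡⟨ +-identityʳ _ ⟩
  lenCount n 1 (r + 2)                ≡⟨ lenCount-ones n (r + 2) ⟩
  lenCount 0 0 (2 * n + (r + 2))      ≡⟨ cong (lenCount 0 0) (regroup n r) ⟩
  lenCount 0 0 (2 * suc n + r)        ∎
  where
  open ≡-Reasoning
  term : ℕ → ℕ
  term i = lenCount (n ∸ i) (suc i) (r + 2)
  regroup : ∀ n r → 2 * n + (r + 2) ≡ 2 * suc n + r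
  regroup = solve-∀

lenCount-split : ∀ n k r → k ≤ n →
  lenCount (suc n) (suc k) r ≡ lenCount (suc n) k r + lenCount (n ∸ k) (suc k) (r + 2)
lenCount-split n k r k≤n rewrite lenCount-suc n k r | lenCount-suc n (suc k) r
  | m≥n⇒m⊓n≡n k≤n | m≥n⇒m⊓n≡n (m≤n⇒m≤1+n k≤n) = ∑<-last k (λ i → lenCount (n ∸ i) (suc i) (r + 2))

lenCount-monoʳ : ∀ n k r → lenCount n k r ≤ lenCount n (suc k) r
lenCount-monoʳ zero    k r = ≤-refl
lenCount-monoʳ (suc n) k r rewrite lenCount-suc n k r | lenCount-suc n (suc k) r =
  ∑<-monoˡ-≤ (λ i → lenCount (n ∸ i) (suc i) (r + 2)) (⊓-monoʳ-≤ (suc n) (n≤1+n k))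

-- Appending a part 1 adds 2 ≡ −1 (mod 3) to 2 · length, which the shift of r by 1 compensates.
lenCount-append1 : ∀ n k r → lenCount n (suc k) r ≤ lenCount (suc n) (suc k) (r + 1)
lenCount-append1 n k r = below n k r ≤-refl
  where
  below : ∀ B {n} k r → n ≤ B → lenCount n (suc k) r ≤ lenCount (suc n) (suc k) (r + 1)
  below B {zero} k r _ = ≤-reflexive (begin
    lenCount 0 0 r                  ≡⟨ lenCount-+3 0 0 r ⟨
    lenCount 0 0 (r + 3)            ≡⟨ cong (lenCount 0 0) (+-assoc r 1 2) ⟨
    lenCount 0 0 (r + 1 + 2)        ≡⟨ +-identityʳ _ ⟨
    lenCount 0 0 (r + 1 + 2) + 0    ≡⟨ lenCount-suc 0 (suc k) (r + 1) ⟨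
    lenCount 1 (suc k) (r + 1)      ∎)
    where open ≡-Reasoning
  below (suc B) {suc n} k r (s≤s n≤B) rewrite lenCount-suc n (suc k) r | lenCount-suc (suc n) (suc k) (r + 1) =
    begin
    ∑< (suc n ⊓ suc k) (λ i → lenCount (n ∸ i) (suc i) (r + 2))
      ≤⟨ ∑<-mono-≤ (suc n ⊓ suc k) termwise ⟩
    ∑< (suc n ⊓ suc k) (λ i → lenCount (suc n ∸ i) (suc i) (r + 1 + 2))
      ≤⟨ ∑<-monoˡ-≤ (λ i → lenCount (suc n ∸ i) (suc i) (r + 1 + 2)) (⊓-monoˡ-≤ (suc k) (n≤1+n (suc n))) ⟩
    ∑< (suc (suc n) ⊓ suc k) (λ i → lenCount (suc n ∸ i) (suc i) (r + 1 + 2))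
      ∎
    where
    open ≤-Reasoning
    termwise : ∀ i → i < suc n ⊓ suc k → lenCount (n ∸ i) (suc i) (r + 2) ≤ lenCount (suc n ∸ i) (suc i) (r + 1 + 2)
    termwise i i<n⊓k = subst₂ (λ a b → lenCount (n ∸ i) (suc i) (r + 2) ≤ lenCount a (suc i) b)
      (sym (+-∸-assoc 1 i≤n)) (regroup r)
      (below B i (r + 2) (≤-trans (m∸n≤m n i) n≤B))
      where
      i≤n : i ≤ n
      i≤n = ≤-pred (≤-trans i<n⊓k (m⊓n≤m (suc n) (suc k)))
      regroup : ∀ r → r + 2 + 1 ≡ r + 1 + 2
      regroup = solve-∀

-- The rank ≡ 1 partitions (1,…,1), (2,2,…) with parts ≤ 2, and (m + 3) of m + 3, none of which
-- comes from a partition of m + 1 by raising the largest part and appending a 1.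
slack : ℕ → ℕ
slack m = lenCount (2 + m) 1 3 + lenCount (m ∸ 1) 2 6 + lenCount 0 0 (5 + m)

N13[1+m]+slack≤N13[3+m] : ∀ m → 1 ≤ m → N13 (suc m) + slack m ≤ N13 (3 + m)
N13[1+m]+slack≤N13[3+m] m 1≤m = begin
  N13 (suc m) + slack m
    ≡⟨ cong (_+ slack m) (N13-suc m) ⟩
  (F 0 + ∑< m (F ∘ suc)) + (G 0 + X + Y)
    ≡⟨ regroup (F 0) (∑< m (F ∘ suc)) (G 0) X Y ⟩
  G 0 + ((F 0 + X + ∑< m (F ∘ suc)) + Y)
    ≤⟨ +-monoʳ-≤ (G 0) (+-monoˡ-≤ Y (+-mono-≤ first (∑<-mono-≤ m middle))) ⟩
  G 0 + ((G 1 + ∑< m (G ∘ suc ∘ suc)) + Y)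
    ≡⟨ cong (λ t → G 0 + (∑< (suc m) (G ∘ suc) + t)) (sym last) ⟩
  G 0 + (∑< (suc m) (G ∘ suc) + G (2 + m))
    ≡⟨ cong (G 0 +_) (sym (∑<-last (suc m) (G ∘ suc))) ⟩
  ∑< (3 + m) G
    ≡⟨ N13-suc (2 + m) ⟨
  N13 (3 + m)
    ∎
  where
  open ≤-Reasoning
  F G : ℕ → ℕ
  F i = lenCount (m ∸ i) (suc i) (i + 3)
  G i = lenCount (2 + m ∸ i) (suc i) (i + 3)
  X Y : ℕ
  X = lenCount (m ∸ 1) 2 6
  Y = lenCount 0 0 (5 + m)

  regroup : ∀ a b c d e → (a + b) + (c + d + e) ≡ c + ((a + d + b) + e)
  regroup = solve-∀

  first : F 0 + X ≤ G 1
  first = begin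
    lenCount m 1 3 + X          ≤⟨ +-monoˡ-≤ X (lenCount-append1 m 0 3) ⟩
    lenCount (suc m) 1 4 + X    ≡⟨ lenCount-split m 1 4 1≤m ⟨
    lenCount (suc m) 2 4        ∎

  middle : ∀ i → i < m → F (suc i) ≤ G (2 + i)
  middle i i<m = begin
    lenCount (m ∸ suc i) (2 + i) (suc i + 3)             ≤⟨ lenCount-append1 (m ∸ suc i) (suc i) _ ⟩
    lenCount (suc (m ∸ suc i)) (2 + i) (suc i + 3 + 1)   ≤⟨ lenCount-monoʳ (suc (m ∸ suc i)) (2 + i) _ ⟩
    lenCount (suc (m ∸ suc i)) (3 + i) (suc i + 3 + 1)   ≡⟨ cong₂ (λ a b → lenCount a (3 + i) b)
                                                              (sym (+-∸-assoc 1 i<m)) (regroup′ i) ⟩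
    lenCount (m ∸ i) (3 + i) (2 + i + 3)                 ∎
    where
    regroup′ : ∀ i → suc i + 3 + 1 ≡ 2 + i + 3
    regroup′ = solve-∀

  last : G (2 + m) ≡ Y
  last rewrite n∸n≡0 m = cong (lenCount 0 0) (+-comm (2 + m) 3)

slack-positive : ∀ m → 2 ≤ m → 1 ≤ slack m
slack-positive m 2≤m = subst (λ t → 1 ≤ slack t) (sym m≡r+q*3)
  (by-residue (m % 3) (m / 3) (m%n<n m 3) (subst (2 ≤_) m≡r+q*3 2≤m))
  where
  open ≤-Reasoning
  m≡r+q*3 : m ≡ m % 3 + (m / 3) * 3
  m≡r+q*3 = m≡m%n+[m/n]*n m 3
  by-residue : ∀ r q → r < 3 → 2 ≤ r + q * 3 → 1 ≤ slack (r + q * 3)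
  by-residue 0 q _ _ = begin
    1                                          ≡⟨ lenCount-nil-1+3q 0 (2 * q + 2) ⟨
    lenCount 0 0 (1 + (2 * q + 2) * 3)         ≡⟨ cong (lenCount 0 0) (regroup q) ⟩
    lenCount 0 0 (2 * (2 + q * 3) + 3)         ≡⟨ lenCount-ones (2 + q * 3) 3 ⟨
    lenCount (2 + q * 3) 1 3                   ≤⟨ m≤m+n _ _ ⟩
    lenCount (2 + q * 3) 1 3 + lenCount (q * 3 ∸ 1) 2 6 ≤⟨ m≤m+n _ _ ⟩
    slack (q * 3)                              ∎
    where
    regroup : ∀ q → 1 + (2 * q + 2) * 3 ≡ 2 * (2 + q * 3) + 3
    regroup = solve-∀
  by-residue 1 zero _ (s≤s ())
  by-residue 1 (suc q) _ _ = begin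
    1                                          ≡⟨ lenCount-nil-1+3q 0 (2 * q + 3) ⟨
    lenCount 0 0 (1 + (2 * q + 3) * 3)         ≡⟨ cong (lenCount 0 0) (regroup q) ⟩
    lenCount 0 0 (2 * (1 + q * 3) + 8)         ≡⟨ lenCount-ones (1 + q * 3) 8 ⟨
    lenCount (1 + q * 3) 1 8                   ≤⟨ lenCount-monoʳ (1 + q * 3) 1 8 ⟩
    lenCount (1 + q * 3) 2 8                   ≤⟨ m≤n+m _ _ ⟩
    lenCount (3 + q * 3) 1 6 + lenCount (1 + q * 3) 2 8 ≡⟨ lenCount-split (2 + q * 3) 1 6 (s≤s z≤n) ⟨
    lenCount (3 + q * 3) 2 6                   ≤⟨ m≤n+m _ _ ⟩
    lenCount (6 + q * 3) 1 3 + lenCount (3 + q * 3) 2 6 ≤⟨ m≤m+n _ _ ⟩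
    slack (4 + q * 3)                          ∎
    where
    regroup : ∀ q → 1 + (2 * q + 3) * 3 ≡ 2 * (1 + q * 3) + 8
    regroup = solve-∀
  by-residue 2 q _ _ = begin
    1                                          ≡⟨ lenCount-nil-1+3q 0 (q + 2) ⟨
    lenCount 0 0 (1 + (q + 2) * 3)             ≡⟨ cong (lenCount 0 0) (regroup q) ⟩
    lenCount 0 0 (7 + q * 3)                   ≤⟨ m≤n+m _ _ ⟩
    slack (2 + q * 3)                          ∎
    where
    regroup : ∀ q → 1 + (q + 2) * 3 ≡ 7 + q * 3
    regroup = solve-∀
  by-residue (suc (suc (suc _))) _ (s≤s (s≤s (s≤s ()))) _

N13[a]<N13[2+a] : ∀ {a} → 3 ≤ a → N13 a < N13 (2 + a)
N13[a]<N13[2+a] {suc m} (s≤s 2≤m) = begin-strict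
  N13 (suc m)                 <⟨ m<m+n (N13 (suc m)) (slack-positive m 2≤m) ⟩
  N13 (suc m) + slack m       ≤⟨ N13[1+m]+slack≤N13[3+m] m (≤-trans (s≤s z≤n) 2≤m) ⟩
  N13 (3 + m)                 ∎
  where open ≤-Reasoning

N13P-++ : ∀ xs ys → N13P (xs ++ ys) ≡ N13P xs * N13P ys
N13P-++ xs ys = trans (cong product (map-++ N13 xs ys)) (product-++ (map N13 xs) (map N13 ys))

N13P-↭ : ∀ {xs ys} → xs ↭ ys → N13P xs ≡ N13P ys
N13P-↭ xs↭ys = product-↭ (map⁺ N13 xs↭ys)

∈⇒≤sum : ∀ {x xs} → x ∈ xs → x ≤ sum xs
∈⇒≤sum {xs = y ∷ ys} (here refl)  = m≤m+n y (sum ys)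
∈⇒≤sum {xs = y ∷ ys} (there x∈ys) = ≤-trans (∈⇒≤sum x∈ys) (m≤n+m (sum ys) y)

∈⇒↭∷ : ∀ {x : ℕ} {xs} → x ∈ xs → ∃[ ρ ] xs ↭ x ∷ ρ
∈⇒↭∷ x∈xs with ys , zs , refl ← ∈-∃++ x∈xs = ys ++ zs , shift _ ys zs

∈-∈⇒↭∷∷ : ∀ {x y : ℕ} {xs} → x ∈ xs → y ∈ xs → x ≢ y → ∃[ ρ ] xs ↭ x ∷ y ∷ ρ
∈-∈⇒↭∷∷ x∈xs y∈xs x≢y with ρ , xs↭x∷ρ ← ∈⇒↭∷ x∈xs with ∈-resp-↭ xs↭x∷ρ y∈xs
... | here y≡x    = contradiction (sym y≡x) x≢y
... | there y∈ρ with ρ′ , ρ↭y∷ρ′ ← ∈⇒↭∷ y∈ρ = ρ′ , ↭-trans xs↭x∷ρ (prep _ ρ↭y∷ρ′)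

sort-partition : ∀ {n} xs → All (1 ≤_) xs → sum xs ≡ n → ∃[ μ ] IsPartition n μ × N13P μ ≡ N13P xs
sort-partition xs xs-pos sum≡n =
  sort xs , (sort-↗ xs , All-resp-↭ (↭-sym (sort-↭ xs)) xs-pos , trans (sum-↭ (sort-↭ xs)) sum≡n) ,
  N13P-↭ (sort-↭ xs)
  where open Sort ≥-decTotalOrder

twosAndThree : ℕ → List ℕ
twosAndThree zero          = 2 ∷ []
twosAndThree (suc zero)    = 3 ∷ []
twosAndThree (suc (suc m)) = 2 ∷ twosAndThree m

twosAndThree-pos : ∀ m → All (1 ≤_) (twosAndThree m)
twosAndThree-pos zero          = s≤s z≤n ∷ []
twosAndThree-pos (suc zero)    = s≤s z≤n ∷ []
twosAndThree-pos (suc (suc m)) = s≤s z≤n ∷ twosAndThree-pos m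

twosAndThree-sum : ∀ m → sum (twosAndThree m) ≡ 2 + m
twosAndThree-sum zero          = refl
twosAndThree-sum (suc zero)    = refl
twosAndThree-sum (suc (suc m)) = cong (2 +_) (twosAndThree-sum m)

twosAndThree-N13P : ∀ m → N13P (twosAndThree m) ≡ 1
twosAndThree-N13P zero          = refl
twosAndThree-N13P (suc zero)    = refl
twosAndThree-N13P (suc (suc m)) = trans (*-identityˡ _) (twosAndThree-N13P m)

MaximisesN13P : ℕ → List ℕ → Set
MaximisesN13P n λs = (μ : List ℕ) → IsPartition n μ → N13P μ ≤ N13P λs

maximiser-N13P≢0 : ∀ {n λs} → 2 ≤ n → MaximisesN13P n λs → N13P λs ≢ 0
maximiser-N13P≢0 {suc (suc m)} (s≤s (s≤s z≤n)) maximal N13Pλs≡0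
  with μ , μ-part , μ≡ ← sort-partition (twosAndThree m) (twosAndThree-pos m) (twosAndThree-sum m) =
  contradiction (subst₂ _≤_ (trans μ≡ (twosAndThree-N13P m)) N13Pλs≡0 (maximal μ μ-part)) λ ()

sum-exchange : ∀ {λs} xs ys ρ → λs ↭ xs ++ ρ → sum ys ≡ sum xs → sum (ys ++ ρ) ≡ sum λs
sum-exchange {λs} xs ys ρ λs↭ sum-ys≡ = begin
  sum (ys ++ ρ)       ≡⟨ sum-++ ys ρ ⟩
  sum ys + sum ρ      ≡⟨ cong (_+ sum ρ) sum-ys≡ ⟩
  sum xs + sum ρ      ≡⟨ sum-++ xs ρ ⟨
  sum (xs ++ ρ)       ≡⟨ sum-↭ λs↭ ⟨
  sum λs              ∎
  where open ≡-Reasoning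

maximiser-exchange : ∀ {n λs} xs ys ρ → IsPartition n λs → MaximisesN13P n λs → N13P λs ≢ 0 →
  λs ↭ xs ++ ρ → All (1 ≤_) ys → sum ys ≡ sum xs → N13P ys ≤ N13P xs
maximiser-exchange {λs = λs} xs ys ρ (_ , λs-pos , sum≡n) maximal N13Pλs≢0 λs↭ ys-pos sum-ys≡
  with μ , μ-part , μ≡ ← sort-partition (ys ++ ρ) (++⁺ ys-pos (++⁻ʳ xs (All-resp-↭ λs↭ λs-pos)))
                                        (trans (sum-exchange xs ys ρ λs↭ sum-ys≡) sum≡n) =
  ≮⇒≥ λ xs<ys → <⇒≱ (begin-strict
    N13P λs              ≡⟨ N13Pλs≡ ⟩
    N13P xs * N13P ρ     <⟨ *-monoˡ-< (N13P ρ) {{≢-nonZero N13Pρ≢0}} xs<ys ⟩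
    N13P ys * N13P ρ     ≡⟨ N13P-++ ys ρ ⟨
    N13P (ys ++ ρ)       ≡⟨ μ≡ ⟨
    N13P μ               ∎) (maximal μ μ-part)
  where
  open ≤-Reasoning
  N13Pλs≡ : N13P λs ≡ N13P xs * N13P ρ
  N13Pλs≡ = trans (N13P-↭ λs↭) (N13P-++ xs ρ)
  N13Pρ≢0 : N13P ρ ≢ 0
  N13Pρ≢0 N13Pρ≡0 = N13Pλs≢0 (trans N13Pλs≡ (trans (cong (N13P xs *_) N13Pρ≡0) (*-zeroʳ (N13P xs))))

maximiser-part≡2 : ∀ {n λs a} → IsPartition n λs → MaximisesN13P n λs → N13P λs ≢ 0 →
  2 ∈ λs → a ∈ λs → a ≡ 2
maximiser-part≡2 {a = 0} (_ , λs-pos , _) _ _ _ 0∈λs with () ← lookup λs-pos 0∈λs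
maximiser-part≡2 {a = 1} _ _ N13Pλs≢0 _ 1∈λs = contradiction (0∣⇒≡0 (∈⇒∣product (∈-map⁺ N13 1∈λs))) N13Pλs≢0
maximiser-part≡2 {a = 2} _ _ _ _ _ = refl
maximiser-part≡2 {a = a@(suc (suc (suc _)))} λs-part maximal N13Pλs≢0 2∈λs a∈λs
  with ρ , λs↭ ← ∈-∈⇒↭∷∷ a∈λs 2∈λs (λ ()) =
  contradiction (maximiser-exchange (a ∷ 2 ∷ []) (2 + a ∷ []) ρ λs-part maximal N13Pλs≢0 λs↭
                   (s≤s z≤n ∷ []) (trans (+-identityʳ (2 + a)) (+-comm 2 a)))
                (<⇒≱ (*-monoˡ-< 1 (N13[a]<N13[2+a] {a} (s≤s (s≤s (s≤s z≤n))))))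

maximiser-twos : ∀ {n λs} → IsPartition n λs → MaximisesN13P n λs → N13P λs ≢ 0 →
  2 ∈ λs → All (_≡ 2) λs → (λs ≡ 2 ∷ []) ⊎ (λs ≡ 2 ∷ 2 ∷ [])
maximiser-twos _ _ _ () []
maximiser-twos _ _ _ _ (refl ∷ [])        = inj₁ refl
maximiser-twos _ _ _ _ (refl ∷ refl ∷ []) = inj₂ refl
maximiser-twos {λs = 2 ∷ 2 ∷ 2 ∷ ρ} λs-part maximal N13Pλs≢0 _ (refl ∷ refl ∷ refl ∷ _) =
  contradiction (maximiser-exchange (2 ∷ 2 ∷ 2 ∷ []) (6 ∷ []) ρ λs-part maximal N13Pλs≢0 ↭-refl (s≤s z≤n ∷ []) refl)
                λ { (s≤s ()) }

proposition3p10 : (n : ℕ) → 1 ≤ n → (λs : List ℕ) → IsPartition n λs →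
    ((μ : List ℕ) → IsPartition n μ → N13P μ ≤ N13P λs) →
    2 ∈ λs → (λs ≡ 2 ∷ []) ⊎ (λs ≡ 2 ∷ 2 ∷ [])
-- The hypothesis 1 ≤ n is implied by 2 ∈ λs.
proposition3p10 n _ λs λs-part@(_ , _ , sum≡n) maximal 2∈λs =
  maximiser-twos λs-part maximal N13Pλs≢0 2∈λs (tabulate (maximiser-part≡2 λs-part maximal N13Pλs≢0 2∈λs))
  where
  N13Pλs≢0 : N13P λs ≢ 0
  N13Pλs≢0 = maximiser-N13P≢0 {λs = λs} (subst (2 ≤_) sum≡n (∈⇒≤sum 2∈λs)) maximal
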